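{- Let ${\cal F}$ be a Fano plane. (1) The kernel $T({\cal F})$ of the Radon transform is a $\mathbb Z_2$-vector space of dimension three. (2) $T({\cal F})=\{T_D: D\in{\cal F}^\ast\}\cup\{0\}$. (3) For $f\in{\cal S}({\cal F}^\ast)$, there exists $g\in{\cal S}({\cal F})$ with $g^\bigstar=f$ if and only if for any two triples $(D_1,D_2,D_3)$ and $(D'_1,D'_2,D'_3)$ of distinct concurrent lines, $\sum_{i=1}^3f(D_i)=\sum_{i=1}^3f(D'_i)$. (4) The image of the Radon transform ${\cal S}({\cal F})\to{\cal S}({\cal F}^\ast)$ is $\{T_P,\,T_P+1: P\in{\cal F}\}\cup\{0,1\}$. (5) For $f\in{\cal S}({\cal F})$, there exists $P\in{\cal F}$ with $f^\bigstar=T_P$ or $f^\bigstar\equiv0$ if and only if $f\in{\cal S}_0({\cal F})$. In particular ${\cal S}_0({\cal F})^\bigstar=\{f\in{\cal S}({\cal F}^\ast):\sum_{i=1}^3f(D_i)=0$ for all distinct concurrent lines $D_1,D_2,D_3\}$.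
   Context: A Fano plane ${\cal F}$ is a projective plane with seven points and seven lines; ${\cal F}^\ast$ is its set of lines. ${\cal S}({\cal F})$ (resp. ${\cal S}({\cal F}^\ast)$) is the $\mathbb Z_2$-vector space of functions ${\cal F}\to\mathbb Z_2$ (resp. ${\cal F}^\ast\to\mathbb Z_2$); ${\cal S}_0({\cal F})=\{f\in{\cal S}({\cal F}):\sum_{P\in{\cal F}}f(P)=0\}$. The Radon transform of $f\in{\cal S}({\cal F})$ is $f^\bigstar\in{\cal S}({\cal F}^\ast)$, $f^\bigstar(D)=\sum_{P\in D}f(P)$; $T({\cal F})$ is its kernel. For a line $D$, $T_D\in{\cal S}({\cal F})$ is $T_D(P)=0$ if $P\in D$ and $1$ if $P\notin D$. For a point $P$, $T_P\in{\cal S}({\cal F}^\ast)$ is $T_P(D)=0$ if $P\in D$ and $1$ if $P\notin D$. Three lines are concurrent if they pass through a common point. $1$ denotes the constant function with value $1$. -}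

module Defs where

open import Data.Bool using (Bool; true; false; _∧_; _xor_; not)
open import Data.Fin using (Fin)
open import Data.Nat using (ℕ; zero; suc)
open import Data.Product using (Σ; ∃; _×_; _,_)
open import Relation.Binary.PropositionalEquality using (_≡_; _≢_)
open import Relation.Nullary using (¬_)

-- ℤ₂ is modelled by Bool: addition = xor, multiplication = ∧.

Σ₂ : {n : ℕ} → (Fin n → Bool) → Bool
Σ₂ {zero}  f = false
Σ₂ {suc n} f = f Fin.zero xor Σ₂ (λ i → f (Fin.suc i))

_≗_ : {A : Set} → (A → Bool) → (A → Bool) → Set
f ≗ g = ∀ x → f x ≡ g x
infix 4 _≗_

record FanoPlane : Set where
  field
    inc : Fin 7 → Fin 7 → Bool

  _∈_ : Fin 7 → Fin 7 → Set
  P ∈ D = inc P D ≡ true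

  field
    two-points : ∀ P Q → P ≢ Q →
      ∃ λ D → P ∈ D × Q ∈ D × (∀ D' → P ∈ D' → Q ∈ D' → D' ≡ D)
    two-lines : ∀ D E → D ≢ E →
      ∃ λ P → P ∈ D × P ∈ E × (∀ P' → P' ∈ D → P' ∈ E → P' ≡ P)
    four-points : ∃ λ (A : Fin 4 → Fin 7) →
      (∀ i j → i ≢ j → A i ≢ A j) ×
      (∀ i j k → i ≢ j → j ≢ k → i ≢ k →
        ¬ (∃ λ D → A i ∈ D × A j ∈ D × A k ∈ D))

module _ (F : FanoPlane) where
  open FanoPlane F

  Point Line : Set
  Point = Fin 7
  Line  = Fin 7

  S : Set
  S = Point → Bool

  S* : Set
  S* = Line → Bool

  radon : S → S*
  radon f D = Σ₂ (λ P → inc P D ∧ f P)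

  T-line : Line → S
  T-line D P = not (inc P D)

  T-point : Point → S*
  T-point P D = not (inc P D)

  DistinctConcurrent : Line → Line → Line → Set
  DistinctConcurrent D₁ D₂ D₃ =
    D₁ ≢ D₂ × D₂ ≢ D₃ × D₁ ≢ D₃ × (∃ λ P → P ∈ D₁ × P ∈ D₂ × P ∈ D₃)

  InKernel : S → Set
  InKernel f = radon f ≗ (λ _ → false)

  InImage : S* → Set
  InImage h = ∃ λ g → radon g ≗ h

  InS₀ : S → Set
  InS₀ f = Σ₂ f ≡ false

lincomb : {A : Set} {k : ℕ} → (Fin k → Bool) → (Fin k → (A → Bool)) → A → Bool
lincomb c b x = Σ₂ (λ i → c i ∧ b i x)

-- b is a basis of the ℤ₂-subspace {f | V f}  (so that subspace has dimension k)
IsBasisOf : {A : Set} {k : ℕ} → ((A → Bool) → Set) → (Fin k → (A → Bool)) → Set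
IsBasisOf V b =
  (∀ i → V (b i)) ×
  (∀ c → lincomb c b ≗ (λ _ → false) → ∀ i → c i ≡ false) ×
  (∀ f → V f → ∃ λ c → f ≗ lincomb c b)

-- Every Fano plane is isomorphic to the standard plane Fano₇ on Fin 7: label a quadrangle, its
-- three diagonal points, its six sides and the line through two diagonal points. That line also
-- contains the third diagonal point, because the seven labelled points are distinct and hence
-- exhaust the plane. All six statements are invariant under isomorphism, so it suffices to prove
-- them for Fano₇. There the key observation is that three distinct concurrent lines cover every
-- point an odd number of times, so f★ summed over them equals Σ f. In particular f★ has the same
-- sum over every pencil, and an exhaustive check shows that the functions with this property are
-- exactly T_P, T_P + 1, 0 and 1; the kernel is found by exhaustive check as well.
module Submission where

open import Defs
open import Algebra.Bundles using (CommutativeRing)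
import Algebra.Properties.CommutativeMonoid.Sum as MonoidSum
open import Data.Bool using (Bool; true; false; _∧_; _∨_; _xor_; not)
open import Data.Bool.Properties using (xor-∧-commutativeRing; ∧-distribʳ-xor; ¬-not)
  renaming (_≟_ to _≟ᵇ_)
open import Data.Fin using (Fin; zero; suc; _↑ˡ_; inject₁; punchOut)
open import Data.Fin.Patterns
open import Data.Fin.Permutation
  using (Permutation′; permutation; _⟨$⟩ʳ_; _⟨$⟩ˡ_; inverseʳ; inverseˡ)
open import Data.Fin.Properties using (_≟_; all?; any?; punchOut-injective; injective⇒≤)
import Data.Nat as ℕ
import Data.Nat.Properties as ℕ
open import Data.Product using (∃; _×_; _,_; proj₁; proj₂)
import Data.Product as Product
open import Data.Product.Function.Dependent.Propositional using () renaming (cong to Σ-cong)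
open import Data.Sum using (_⊎_; inj₁; inj₂)
import Data.Sum as Sum
open import Data.Sum.Function.Propositional using (_⊎-⇔_)
open import Data.Vec using (Vec; _∷_; []; lookup)
open import Function using (_∘_)
open import Function.Bundles using (_⇔_; mk⇔; Equivalence)
open import Function.Definitions using (Injective)
import Function.Properties.Equivalence as ⇔
open import Function.Related.Propositional using (equivalence)
open import Relation.Nullary using (Dec; yes; no; does; ¬_; contradiction)
open import Relation.Nullary.Decidable
  using (_×-dec_; _⊎-dec_; _→-dec_; ¬?; map′; False; toWitnessFalse; from-yes)
open import Relation.Binary.PropositionalEquality
  using (_≡_; _≢_; refl; sym; trans; cong; cong₂; subst; module ≡-Reasoning)

open MonoidSum (CommutativeRing.+-commutativeMonoid xor-∧-commutativeRing)
  using (sum; ∑-distrib-+; sum-permute)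

-- Sums over ℤ₂ and exhaustive checks

Σ₂≡sum : ∀ {n} (f : Fin n → Bool) → Σ₂ f ≡ sum f
Σ₂≡sum {ℕ.zero}  f = refl
Σ₂≡sum {ℕ.suc n} f = cong (f zero xor_) (Σ₂≡sum (f ∘ suc))

Σ₂-cong : ∀ {n} {f g : Fin n → Bool} → f ≗ g → Σ₂ f ≡ Σ₂ g
Σ₂-cong {ℕ.zero}  f≗g = refl
Σ₂-cong {ℕ.suc n} f≗g = cong₂ _xor_ (f≗g zero) (Σ₂-cong (f≗g ∘ suc))

Σ₂-distrib-xor : ∀ {n} (f g : Fin n → Bool) → Σ₂ (λ i → f i xor g i) ≡ Σ₂ f xor Σ₂ g
Σ₂-distrib-xor f g = begin
  Σ₂ (λ i → f i xor g i)  ≡⟨ Σ₂≡sum (λ i → f i xor g i) ⟩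
  sum (λ i → f i xor g i) ≡⟨ ∑-distrib-+ f g ⟩
  sum f xor sum g         ≡⟨ cong₂ _xor_ (Σ₂≡sum f) (Σ₂≡sum g) ⟨
  Σ₂ f xor Σ₂ g           ∎
  where open ≡-Reasoning

Σ₂-permute : ∀ {n} (f : Fin n → Bool) (π : Permutation′ n) → Σ₂ (f ∘ (π ⟨$⟩ʳ_)) ≡ Σ₂ f
Σ₂-permute f π = begin
  Σ₂ (f ∘ (π ⟨$⟩ʳ_))  ≡⟨ Σ₂≡sum (f ∘ (π ⟨$⟩ʳ_)) ⟩
  sum (f ∘ (π ⟨$⟩ʳ_)) ≡⟨ sum-permute f π ⟨
  sum f               ≡⟨ Σ₂≡sum f ⟨
  Σ₂ f                ∎
  where open ≡-Reasoning

Σ₂-∧-odd-cover : ∀ {n} (a b c f : Fin n → Bool) → (∀ i → (a i xor b i xor c i) ≡ true) →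
  (Σ₂ (λ i → a i ∧ f i) xor Σ₂ (λ i → b i ∧ f i) xor Σ₂ (λ i → c i ∧ f i)) ≡ Σ₂ f
Σ₂-∧-odd-cover a b c f cover = begin
  Σ₂ (λ i → a i ∧ f i) xor Σ₂ (λ i → b i ∧ f i) xor Σ₂ (λ i → c i ∧ f i)
    ≡⟨ cong (Σ₂ (λ i → a i ∧ f i) xor_) (Σ₂-distrib-xor (λ i → b i ∧ f i) (λ i → c i ∧ f i)) ⟨
  Σ₂ (λ i → a i ∧ f i) xor Σ₂ (λ i → (b i ∧ f i) xor (c i ∧ f i))
    ≡⟨ Σ₂-distrib-xor (λ i → a i ∧ f i) (λ i → (b i ∧ f i) xor (c i ∧ f i)) ⟨
  Σ₂ (λ i → (a i ∧ f i) xor ((b i ∧ f i) xor (c i ∧ f i)))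
    ≡⟨ Σ₂-cong (λ i → factor (a i) (b i) (c i) (f i)) ⟩
  Σ₂ (λ i → (a i xor b i xor c i) ∧ f i)
    ≡⟨ Σ₂-cong (λ i → cong (_∧ f i) (cover i)) ⟩
  Σ₂ f ∎
  where
  open ≡-Reasoning
  factor : ∀ x y z w → ((x ∧ w) xor ((y ∧ w) xor (z ∧ w))) ≡ (x xor y xor z) ∧ w
  factor x y z w = trans (cong ((x ∧ w) xor_) (sym (∧-distribʳ-xor w y z)))
                         (sym (∧-distribʳ-xor w x (y xor z)))

≗-trans : ∀ {A : Set} {f g h : A → Bool} → f ≗ g → g ≗ h → f ≗ h
≗-trans f≗g g≗h x = trans (f≗g x) (g≗h x)

≗-sym : ∀ {A : Set} {f g : A → Bool} → f ≗ g → g ≗ f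
≗-sym f≗g x = sym (f≗g x)

≗-respˡ : ∀ {A : Set} {f f' g : A → Bool} → f ≗ f' → (f ≗ g) ⇔ (f' ≗ g)
≗-respˡ f≗f' = mk⇔ (≗-trans (≗-sym f≗f')) (≗-trans f≗f')

≗-respʳ : ∀ {A : Set} {f g g' : A → Bool} → g ≗ g' → (f ≗ g) ⇔ (f ≗ g')
≗-respʳ g≗g' = mk⇔ (λ f≗g → ≗-trans f≗g g≗g') (λ f≗g' → ≗-trans f≗g' (≗-sym g≗g'))

≡-respˡ : ∀ {a a' b : Bool} → a ≡ a' → (a ≡ b) ⇔ (a' ≡ b)
≡-respˡ a≡a' = mk⇔ (trans (sym a≡a')) (trans a≡a')

_◂_ : ∀ {n} → Bool → (Fin n → Bool) → Fin (ℕ.suc n) → Bool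
(b ◂ u) zero    = b
(b ◂ u) (suc i) = u i

all-functions? : ∀ {n} (P : (Fin n → Bool) → Set) → (∀ {u v} → u ≗ v → P u → P v) →
                 (∀ u → Dec (P u)) → Dec (∀ u → P u)
all-functions? {ℕ.zero}  P resp P? = map′ (λ p u → resp (λ ()) p) (λ p → p _) (P? (λ ()))
all-functions? {ℕ.suc n} P resp P? =
  map′ (λ (t , f) u → resp (split u) (by-head u t f)) (λ p → (λ _ → p _) , (λ _ → p _))
       (all-functions? (P ∘ (true ◂_)) (resp ∘ ◂-cong true) (P? ∘ (true ◂_)) ×-dec
        all-functions? (P ∘ (false ◂_)) (resp ∘ ◂-cong false) (P? ∘ (false ◂_)))
  where
  split : ∀ (u : Fin (ℕ.suc n) → Bool) → (u zero ◂ (u ∘ suc)) ≗ u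
  split u zero    = refl
  split u (suc i) = refl
  ◂-cong : ∀ b {u v : Fin n → Bool} → u ≗ v → (b ◂ u) ≗ (b ◂ v)
  ◂-cong b u≗v zero    = refl
  ◂-cong b u≗v (suc i) = u≗v i
  by-head : ∀ (u : Fin (ℕ.suc n) → Bool) →
    (∀ v → P (true ◂ v)) → (∀ v → P (false ◂ v)) → P (u zero ◂ (u ∘ suc))
  by-head u t f with u zero
  ... | true  = t _
  ... | false = f _

injective⇒surjective : ∀ {n} {f : Fin n → Fin n} → Injective _≡_ _≡_ f → ∀ y → ∃ λ x → f x ≡ y
injective⇒surjective {ℕ.suc n} {f} f-injective y with any? (λ x → f x ≟ y)
... | yes hit  = hit
... | no  miss = contradiction (injective⇒≤ punched-injective) ℕ.1+n≰n
  where
  punched : Fin (ℕ.suc n) → Fin n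
  punched x = punchOut {i = y} {j = f x} λ y≡fx → miss (x , sym y≡fx)
  punched-injective : Injective _≡_ _≡_ punched
  punched-injective {x} {x'} =
    f-injective ∘ punchOut-injective (λ y≡fx → miss (x , sym y≡fx)) (λ y≡fx' → miss (x' , sym y≡fx'))

injective⇒permutation : ∀ {n} (f : Fin n → Fin n) → Injective _≡_ _≡_ f → Permutation′ n
injective⇒permutation f f-injective =
  permutation f (proj₁ ∘ surjective) (proj₂ ∘ surjective) (λ x → f-injective (proj₂ (surjective (f x))))
  where
  surjective : ∀ y → ∃ λ x → f x ≡ y
  surjective = injective⇒surjective f-injective

∀-⟨$⟩ʳ : ∀ {n} (π : Permutation′ n) {X : Fin n → Set} → (∀ i → X (π ⟨$⟩ʳ i)) → ∀ j → X j
∀-⟨$⟩ʳ π {X} all j = subst X (inverseʳ π) (all (π ⟨$⟩ˡ j))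

⟨$⟩ʳ-injective : ∀ {n} (π : Permutation′ n) {i j} → π ⟨$⟩ʳ i ≡ π ⟨$⟩ʳ j → i ≡ j
⟨$⟩ʳ-injective π πi≡πj = trans (sym (inverseˡ π)) (trans (cong (π ⟨$⟩ˡ_) πi≡πj) (inverseˡ π))

≗-⟨$⟩ʳ : ∀ {n} (π : Permutation′ n) {f g : Fin n → Bool} → (f ∘ (π ⟨$⟩ʳ_) ≗ g ∘ (π ⟨$⟩ʳ_)) ⇔ (f ≗ g)
≗-⟨$⟩ʳ π = mk⇔ (∀-⟨$⟩ʳ π) (λ f≗g → f≗g ∘ (π ⟨$⟩ʳ_))

-- The six statements, and their proof for the standard Fano plane

module _ (F : FanoPlane) where

  KernelBasis : Set
  KernelBasis = ∃ λ (b : Fin 3 → S F) → IsBasisOf (InKernel F) b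

  KernelCharacterisation : Set
  KernelCharacterisation = ∀ (f : S F) → InKernel F f ⇔
    ((∃ λ (D : Line F) → f ≗ T-line F D) ⊎ f ≗ (λ _ → false))

  ImageCriterion : Set
  ImageCriterion = ∀ (f : S* F) → InImage F f ⇔
    (∀ D₁ D₂ D₃ D₁' D₂' D₃' → DistinctConcurrent F D₁ D₂ D₃ →
      DistinctConcurrent F D₁' D₂' D₃' →
      (f D₁ xor f D₂ xor f D₃) ≡ (f D₁' xor f D₂' xor f D₃'))

  ImageCharacterisation : Set
  ImageCharacterisation = ∀ (f : S* F) → InImage F f ⇔
    ((∃ λ (P : Point F) → f ≗ T-point F P ⊎ f ≗ (λ D → not (T-point F P D)))
      ⊎ f ≗ (λ _ → false) ⊎ f ≗ (λ _ → true))

  S₀Criterion : Set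
  S₀Criterion = ∀ (f : S F) →
    ((∃ λ (P : Point F) → radon F f ≗ T-point F P) ⊎ radon F f ≗ (λ _ → false)) ⇔ InS₀ F f

  S₀ImageCriterion : Set
  S₀ImageCriterion = ∀ (h : S* F) → (∃ λ (g : S F) → InS₀ F g × radon F g ≗ h) ⇔
    (∀ D₁ D₂ D₃ → DistinctConcurrent F D₁ D₂ D₃ → (h D₁ xor h D₂ xor h D₃) ≡ false)

  radon-cong : ∀ {f g : S F} → f ≗ g → radon F f ≗ radon F g
  radon-cong f≗g D = Σ₂-cong (λ P → cong (FanoPlane.inc F P D ∧_) (f≗g P))

_∈ᵇ_ : Fin 7 → Fin 7 × Fin 7 × Fin 7 → Bool
P ∈ᵇ (X , Y , Z) = does (P ≟ X) ∨ does (P ≟ Y) ∨ does (P ≟ Z)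

-- Points 0–3 form a quadrangle and 4, 5, 6 are its diagonal points; lines 0–5 are the sides
-- 01, 02, 03, 12, 13, 23 of the quadrangle and line 6 is the diagonal line.
standardLine : Fin 7 → Fin 7 × Fin 7 × Fin 7
standardLine 0F = 0F , 1F , 4F
standardLine 1F = 0F , 2F , 5F
standardLine 2F = 0F , 3F , 6F
standardLine 3F = 1F , 2F , 6F
standardLine 4F = 1F , 3F , 5F
standardLine 5F = 2F , 3F , 4F
standardLine 6F = 4F , 5F , 6F

inc₇ : Fin 7 → Fin 7 → Bool
inc₇ P D = P ∈ᵇ standardLine D

inc₇? : ∀ P D → Dec (inc₇ P D ≡ true)
inc₇? P D = inc₇ P D ≟ᵇ true

Fano₇ : FanoPlane
Fano₇ = record
  { inc = inc₇
  ; two-points = from-yes (all? λ P → all? λ Q → ¬? (P ≟ Q) →-dec any? λ D →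
      inc₇? P D ×-dec inc₇? Q D ×-dec all? λ D' → inc₇? P D' →-dec inc₇? Q D' →-dec D' ≟ D)
  ; two-lines = from-yes (all? λ D → all? λ E → ¬? (D ≟ E) →-dec any? λ P →
      inc₇? P D ×-dec inc₇? P E ×-dec all? λ P' → inc₇? P' D →-dec inc₇? P' E →-dec P' ≟ P)
  ; four-points = quadrangle
      , from-yes (all? λ i → all? λ j → ¬? (i ≟ j) →-dec ¬? (quadrangle i ≟ quadrangle j))
      , from-yes (all? λ i → all? λ j → all? λ k → ¬? (i ≟ j) →-dec ¬? (j ≟ k) →-dec ¬? (i ≟ k) →-dec
          ¬? (any? λ D → inc₇? (quadrangle i) D ×-dec inc₇? (quadrangle j) D ×-dec inc₇? (quadrangle k) D))
  }
  where
  quadrangle : Fin 4 → Fin 7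
  quadrangle = _↑ˡ 3

kernel-characterisation₇ : KernelCharacterisation Fano₇
kernel-characterisation₇ f = mk⇔ (proj₁ (both f)) (proj₂ (both f))
  where
  Shape : S Fano₇ → Set
  Shape f = (∃ λ D → f ≗ T-line Fano₇ D) ⊎ f ≗ (λ _ → false)
  kernel-resp : ∀ {f g} → f ≗ g → InKernel Fano₇ f → InKernel Fano₇ g
  kernel-resp f≗g = ≗-trans (≗-sym (radon-cong Fano₇ f≗g))
  shape-resp : ∀ {f g} → f ≗ g → Shape f → Shape g
  shape-resp f≗g = Sum.map (Product.map₂ (≗-trans (≗-sym f≗g))) (≗-trans (≗-sym f≗g))
  both : ∀ f → (InKernel Fano₇ f → Shape f) × (Shape f → InKernel Fano₇ f)
  both = from-yes (all-functions? (λ f → (InKernel Fano₇ f → Shape f) × (Shape f → InKernel Fano₇ f))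
    (λ f≗g (⇒ , ⇐) → shape-resp f≗g ∘ ⇒ ∘ kernel-resp (≗-sym f≗g) , kernel-resp f≗g ∘ ⇐ ∘ shape-resp (≗-sym f≗g))
    λ f → let kernel? = all? λ D → radon Fano₇ f D ≟ᵇ false
              shape?  = (any? λ D → all? λ P → f P ≟ᵇ T-line Fano₇ D P) ⊎-dec all? λ P → f P ≟ᵇ false
          in (kernel? →-dec shape?) ×-dec (shape? →-dec kernel?))

basisLine : Fin 3 → Fin 7
basisLine 0F = 0F
basisLine 1F = 1F
basisLine 2F = 3F

basis₇ : Fin 3 → S Fano₇
basis₇ = T-line Fano₇ ∘ basisLine

coordinates : Fin 7 → Fin 3 → Bool
coordinates D = lookup (table D)
  where
  table : Fin 7 → Vec Bool 3
  table 0F = true  ∷ false ∷ false ∷ []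
  table 1F = false ∷ true  ∷ false ∷ []
  table 2F = true  ∷ true  ∷ false ∷ []
  table 3F = false ∷ false ∷ true  ∷ []
  table 4F = true  ∷ false ∷ true  ∷ []
  table 5F = false ∷ true  ∷ true  ∷ []
  table 6F = true  ∷ true  ∷ true  ∷ []

basis₇-spans : ∀ D → T-line Fano₇ D ≗ lincomb (coordinates D) basis₇
basis₇-spans = from-yes (all? λ D → all? λ P → T-line Fano₇ D P ≟ᵇ lincomb (coordinates D) basis₇ P)

basis₇-independent : ∀ c → lincomb c basis₇ ≗ (λ _ → false) → ∀ k → c k ≡ false
basis₇-independent = from-yes (all-functions? (λ c → lincomb c basis₇ ≗ (λ _ → false) → ∀ k → c k ≡ false)
  (λ {c} {d} c≗d independent d-trivial k →
    trans (sym (c≗d k)) (independent (λ P → trans (Σ₂-cong λ i → cong (_∧ basis₇ i P) (c≗d i)) (d-trivial P)) k))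
  λ c → (all? λ P → lincomb c basis₇ P ≟ᵇ false) →-dec all? λ k → c k ≟ᵇ false)

kernel-basis₇ : KernelBasis Fano₇
kernel-basis₇ =
  basis₇ ,
  (λ k → Equivalence.from (kernel-characterisation₇ (basis₇ k)) (inj₁ (basisLine k , λ _ → refl))) ,
  basis₇-independent ,
  λ f f∈T → spanned f (Equivalence.to (kernel-characterisation₇ f) f∈T)
  where
  spanned : ∀ f → (∃ λ D → f ≗ T-line Fano₇ D) ⊎ f ≗ (λ _ → false) → ∃ λ c → f ≗ lincomb c basis₇
  spanned f (inj₁ (D , f≗T)) = coordinates D , ≗-trans f≗T (basis₇-spans D)
  spanned f (inj₂ f≗0)       = (λ _ → false) , f≗0

pencil : Fin 7 → Fin 3 → Fin 7
pencil P = lookup (table P)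
  where
  table : Fin 7 → Vec (Fin 7) 3
  table 0F = 0F ∷ 1F ∷ 2F ∷ []
  table 1F = 0F ∷ 3F ∷ 4F ∷ []
  table 2F = 1F ∷ 3F ∷ 5F ∷ []
  table 3F = 2F ∷ 4F ∷ 5F ∷ []
  table 4F = 0F ∷ 5F ∷ 6F ∷ []
  table 5F = 1F ∷ 4F ∷ 6F ∷ []
  table 6F = 2F ∷ 3F ∷ 6F ∷ []

Σ-pencil : S* Fano₇ → Fin 7 → Bool
Σ-pencil h P = h (pencil P 0F) xor h (pencil P 1F) xor h (pencil P 2F)

Σ-pencil-cong : ∀ {h h'} → h ≗ h' → ∀ P → Σ-pencil h P ≡ Σ-pencil h' P
Σ-pencil-cong h≗h' P = cong₂ _xor_ (h≗h' _) (cong₂ _xor_ (h≗h' _) (h≗h' _))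

distinct-concurrent? : ∀ D₁ D₂ D₃ → Dec (DistinctConcurrent Fano₇ D₁ D₂ D₃)
distinct-concurrent? D₁ D₂ D₃ = ¬? (D₁ ≟ D₂) ×-dec ¬? (D₂ ≟ D₃) ×-dec ¬? (D₁ ≟ D₃) ×-dec
  any? λ P → inc₇? P D₁ ×-dec inc₇? P D₂ ×-dec inc₇? P D₃

pencil-distinct-concurrent : ∀ P → DistinctConcurrent Fano₇ (pencil P 0F) (pencil P 1F) (pencil P 2F)
pencil-distinct-concurrent = from-yes (all? λ P → distinct-concurrent? (pencil P 0F) (pencil P 1F) (pencil P 2F))

concurrent-odd-cover : ∀ D₁ D₂ D₃ → DistinctConcurrent Fano₇ D₁ D₂ D₃ →
  ∀ P → (inc₇ P D₁ xor inc₇ P D₂ xor inc₇ P D₃) ≡ true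
concurrent-odd-cover = from-yes (all? λ D₁ → all? λ D₂ → all? λ D₃ →
  distinct-concurrent? D₁ D₂ D₃ →-dec all? λ P → (inc₇ P D₁ xor inc₇ P D₂ xor inc₇ P D₃) ≟ᵇ true)

concurrent-sum-of-image : ∀ g {h} → radon Fano₇ g ≗ h → ∀ {D₁ D₂ D₃} → DistinctConcurrent Fano₇ D₁ D₂ D₃ →
  (h D₁ xor h D₂ xor h D₃) ≡ Σ₂ g
concurrent-sum-of-image g g★≗h {D₁} {D₂} {D₃} dc =
  trans (sym (cong₂ _xor_ (g★≗h D₁) (cong₂ _xor_ (g★≗h D₂) (g★≗h D₃))))
        (Σ₂-∧-odd-cover (λ P → inc₇ P D₁) (λ P → inc₇ P D₂) (λ P → inc₇ P D₃) g (concurrent-odd-cover D₁ D₂ D₃ dc))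

Σ-pencil-radon : ∀ g P → Σ-pencil (radon Fano₇ g) P ≡ Σ₂ g
Σ-pencil-radon g P = concurrent-sum-of-image g (λ _ → refl) (pencil-distinct-concurrent P)

ImageShape : S* Fano₇ → Set
ImageShape h = (∃ λ P → h ≗ T-point Fano₇ P ⊎ h ≗ (λ D → not (T-point Fano₇ P D)))
               ⊎ h ≗ (λ _ → false) ⊎ h ≗ (λ _ → true)

pencil-constant⇒image-shape : ∀ h → (∀ P → Σ-pencil h P ≡ Σ-pencil h 0F) → ImageShape h
pencil-constant⇒image-shape = from-yes (all-functions? (λ h → (∀ P → Σ-pencil h P ≡ Σ-pencil h 0F) → ImageShape h)
  resp λ h →
  (all? λ P → Σ-pencil h P ≟ᵇ Σ-pencil h 0F) →-dec
  ((any? λ P → (all? λ D → h D ≟ᵇ T-point Fano₇ P D) ⊎-dec (all? λ D → h D ≟ᵇ not (T-point Fano₇ P D)))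
   ⊎-dec (all? λ D → h D ≟ᵇ false) ⊎-dec (all? λ D → h D ≟ᵇ true)))
  where
  resp : ∀ {h h'} → h ≗ h' → ((∀ P → Σ-pencil h P ≡ Σ-pencil h 0F) → ImageShape h) →
                             ((∀ P → Σ-pencil h' P ≡ Σ-pencil h' 0F) → ImageShape h')
  resp {h} {h'} h≗h' shape constant =
    Sum.map (Product.map₂ (Sum.map transport transport)) (Sum.map transport transport)
      (shape λ P → trans (Σ-pencil-cong h≗h' P) (trans (constant P) (sym (Σ-pencil-cong h≗h' 0F))))
    where
    transport : ∀ {w} → h ≗ w → h' ≗ w
    transport = ≗-trans (≗-sym h≗h')

Σ-pencil-T-point : ∀ P Q → Σ-pencil (T-point Fano₇ P) Q ≡ false
Σ-pencil-T-point = from-yes (all? λ P → all? λ Q → Σ-pencil (T-point Fano₇ P) Q ≟ᵇ false)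

Σ-pencil-not-T-point : ∀ P Q → Σ-pencil (λ D → not (T-point Fano₇ P D)) Q ≡ true
Σ-pencil-not-T-point = from-yes (all? λ P → all? λ Q → Σ-pencil (λ D → not (T-point Fano₇ P D)) Q ≟ᵇ true)

point-indicator : Fin 7 → S Fano₇
point-indicator P Q = does (Q ≟ P)

radon-point-indicator : ∀ P → radon Fano₇ (point-indicator P) ≗ (λ D → not (T-point Fano₇ P D))
radon-point-indicator = from-yes (all? λ P → all? λ D →
  radon Fano₇ (point-indicator P) D ≟ᵇ not (T-point Fano₇ P D))

radon-point-complement : ∀ P → radon Fano₇ (not ∘ point-indicator P) ≗ T-point Fano₇ P
radon-point-complement = from-yes (all? λ P → all? λ D →
  radon Fano₇ (not ∘ point-indicator P) D ≟ᵇ T-point Fano₇ P D)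

point-complement∈S₀ : ∀ P → InS₀ Fano₇ (not ∘ point-indicator P)
point-complement∈S₀ = from-yes (all? λ P → Σ₂ (not ∘ point-indicator P) ≟ᵇ false)

radon-constant : ∀ b → radon Fano₇ (λ _ → b) ≗ (λ _ → b)
radon-constant false = from-yes (all? λ D → radon Fano₇ (λ _ → false) D ≟ᵇ false)
radon-constant true  = from-yes (all? λ D → radon Fano₇ (λ _ → true) D ≟ᵇ true)

image-shape⇒image : ∀ h → ImageShape h → InImage Fano₇ h
image-shape⇒image h (inj₁ (P , inj₁ h≗T))   = not ∘ point-indicator P , ≗-trans (radon-point-complement P) (≗-sym h≗T)
image-shape⇒image h (inj₁ (P , inj₂ h≗T+1)) = point-indicator P , ≗-trans (radon-point-indicator P) (≗-sym h≗T+1)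
image-shape⇒image h (inj₂ (inj₁ h≗0))       = (λ _ → false) , ≗-trans (radon-constant false) (≗-sym h≗0)
image-shape⇒image h (inj₂ (inj₂ h≗1))       = (λ _ → true) , ≗-trans (radon-constant true) (≗-sym h≗1)

pencil-balanced⇒T-point-or-0 : ∀ h → (∀ P → Σ-pencil h P ≡ false) →
  (∃ λ P → h ≗ T-point Fano₇ P) ⊎ h ≗ (λ _ → false)
pencil-balanced⇒T-point-or-0 h balanced =
  restrict (pencil-constant⇒image-shape h λ P → trans (balanced P) (sym (balanced 0F)))
  where
  restrict : ImageShape h → (∃ λ P → h ≗ T-point Fano₇ P) ⊎ h ≗ (λ _ → false)
  restrict (inj₁ (P , inj₁ h≗T))   = inj₁ (P , h≗T)
  restrict (inj₁ (P , inj₂ h≗T+1))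
    with () ← trans (sym (Σ-pencil-not-T-point P 0F)) (trans (sym (Σ-pencil-cong h≗T+1 0F)) (balanced 0F))
  restrict (inj₂ (inj₁ h≗0))       = inj₂ h≗0
  restrict (inj₂ (inj₂ h≗1))
    with () ← trans (sym (Σ-pencil-cong h≗1 0F)) (balanced 0F)

image-criterion₇ : ImageCriterion Fano₇
image-criterion₇ h = mk⇔
  (λ (g , g★≗h) _ _ _ _ _ _ dc dc' →
    trans (concurrent-sum-of-image g g★≗h dc) (sym (concurrent-sum-of-image g g★≗h dc')))
  (λ equal → image-shape⇒image h (pencil-constant⇒image-shape h λ P →
    equal _ _ _ _ _ _ (pencil-distinct-concurrent P) (pencil-distinct-concurrent 0F)))

image-characterisation₇ : ImageCharacterisation Fano₇
image-characterisation₇ h = mk⇔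
  (λ h∈image → pencil-constant⇒image-shape h λ P →
    Equivalence.to (image-criterion₇ h) h∈image _ _ _ _ _ _
      (pencil-distinct-concurrent P) (pencil-distinct-concurrent 0F))
  (image-shape⇒image h)

S₀-criterion₇ : S₀Criterion Fano₇
S₀-criterion₇ f = mk⇔ to λ f∈S₀ →
  pencil-balanced⇒T-point-or-0 (radon Fano₇ f) (λ P → trans (Σ-pencil-radon f P) f∈S₀)
  where
  to : (∃ λ P → radon Fano₇ f ≗ T-point Fano₇ P) ⊎ radon Fano₇ f ≗ (λ _ → false) → InS₀ Fano₇ f
  to (inj₁ (P , f★≗T)) = trans (sym (Σ-pencil-radon f 0F)) (trans (Σ-pencil-cong f★≗T 0F) (Σ-pencil-T-point P 0F))
  to (inj₂ f★≗0)       = trans (sym (Σ-pencil-radon f 0F)) (Σ-pencil-cong f★≗0 0F)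

S₀-image-criterion₇ : S₀ImageCriterion Fano₇
S₀-image-criterion₇ h = mk⇔
  (λ (g , g∈S₀ , g★≗h) _ _ _ dc → trans (concurrent-sum-of-image g g★≗h dc) g∈S₀)
  (λ balanced → preimage (pencil-balanced⇒T-point-or-0 h λ P → balanced _ _ _ (pencil-distinct-concurrent P)))
  where
  preimage : (∃ λ P → h ≗ T-point Fano₇ P) ⊎ h ≗ (λ _ → false) →
             ∃ λ g → InS₀ Fano₇ g × radon Fano₇ g ≗ h
  preimage (inj₁ (P , h≗T)) =
    not ∘ point-indicator P , point-complement∈S₀ P , ≗-trans (radon-point-complement P) (≗-sym h≗T)
  preimage (inj₂ h≗0) = (λ _ → false) , refl , ≗-trans (radon-constant false) (≗-sym h≗0)

-- Invariance under isomorphism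

record _≅_ (F G : FanoPlane) : Set where
  field
    point     : Permutation′ 7
    line      : Permutation′ 7
    incidence : ∀ P D → FanoPlane.inc G (point ⟨$⟩ʳ P) (line ⟨$⟩ʳ D) ≡ FanoPlane.inc F P D

module Invariance {F G : FanoPlane} (φ : F ≅ G) where
  open _≅_ φ
  open FanoPlane using (inc)

  p : Point F → Point G
  p = point ⟨$⟩ʳ_

  ℓ : Line F → Line G
  ℓ = line ⟨$⟩ʳ_

  pushforward : S F → S G
  pushforward g = g ∘ (point ⟨$⟩ˡ_)

  pushforward-pullback : ∀ g → pushforward g ∘ p ≗ g
  pushforward-pullback g P = cong g (inverseˡ point)

  Σ₂-pushforward : ∀ g → Σ₂ (pushforward g) ≡ Σ₂ g
  Σ₂-pushforward g = trans (sym (Σ₂-permute (pushforward g) point)) (Σ₂-cong (pushforward-pullback g))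

  radon-pullback : ∀ g D → radon F (g ∘ p) D ≡ radon G g (ℓ D)
  radon-pullback g D = trans (Σ₂-cong λ P → cong (_∧ g (p P)) (sym (incidence P D)))
                             (Σ₂-permute (λ Q → inc G Q (ℓ D) ∧ g Q) point)

  radon-pushforward : ∀ g {h} → radon F g ≗ h ∘ ℓ → radon G (pushforward g) ≗ h
  radon-pushforward g g★≗h = ∀-⟨$⟩ʳ line λ D →
    trans (sym (radon-pullback (pushforward g) D)) (trans (radon-cong F (pushforward-pullback g) D) (g★≗h D))

  ≗-by-line : ∀ (t : Bool → Bool) f D → (f ∘ p ≗ (λ P → t (inc F P D))) ⇔ (f ≗ (λ Q → t (inc G Q (ℓ D))))
  ≗-by-line t f D = ⇔.trans (≗-respʳ λ P → cong t (sym (incidence P D))) (≗-⟨$⟩ʳ point)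

  ≗-by-point : ∀ (t : Bool → Bool) h P → (h ∘ ℓ ≗ (λ D → t (inc F P D))) ⇔ (h ≗ (λ E → t (inc G (p P) E)))
  ≗-by-point t h P = ⇔.trans (≗-respʳ λ D → cong t (sym (incidence P D))) (≗-⟨$⟩ʳ line)

  distinct-concurrent-pullback : ∀ D₁ D₂ D₃ →
    DistinctConcurrent F D₁ D₂ D₃ ⇔ DistinctConcurrent G (ℓ D₁) (ℓ D₂) (ℓ D₃)
  distinct-concurrent-pullback D₁ D₂ D₃ = mk⇔
    (λ (D₁≢D₂ , D₂≢D₃ , D₁≢D₃ , P , P∈D₁ , P∈D₂ , P∈D₃) →
      D₁≢D₂ ∘ ⟨$⟩ʳ-injective line , D₂≢D₃ ∘ ⟨$⟩ʳ-injective line , D₁≢D₃ ∘ ⟨$⟩ʳ-injective line ,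
      p P , trans (incidence P D₁) P∈D₁ , trans (incidence P D₂) P∈D₂ , trans (incidence P D₃) P∈D₃)
    (λ (E₁≢E₂ , E₂≢E₃ , E₁≢E₃ , Q , Q∈E₁ , Q∈E₂ , Q∈E₃) →
      E₁≢E₂ ∘ cong ℓ , E₂≢E₃ ∘ cong ℓ , E₁≢E₃ ∘ cong ℓ ,
      point ⟨$⟩ˡ Q , on D₁ Q∈E₁ , on D₂ Q∈E₂ , on D₃ Q∈E₃)
    where
    on : ∀ {Q} D → inc G Q (ℓ D) ≡ true → inc F (point ⟨$⟩ˡ Q) D ≡ true
    on D Q∈D = trans (sym (incidence _ D)) (subst (λ Q' → inc G Q' (ℓ D) ≡ true) (sym (inverseʳ point)) Q∈D)

  kernel-basis-invariant : KernelBasis F → KernelBasis G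
  kernel-basis-invariant (b , b∈T , independent , spanning) =
    pushforward ∘ b ,
    (λ k → ∀-⟨$⟩ʳ line λ D → trans (sym (radon-pullback (pushforward (b k)) D))
                                   (trans (radon-cong F (pushforward-pullback (b k)) D) (b∈T k D))) ,
    (λ c trivial → independent c λ P → trans (lincomb-pushforward c P) (trivial (p P))) ,
    λ f f∈T → let (c , f∘p≗) = spanning (f ∘ p) (λ D → trans (radon-pullback f D) (f∈T (ℓ D)))
              in c , ∀-⟨$⟩ʳ point λ P → trans (f∘p≗ P) (lincomb-pushforward c P)
    where
    lincomb-pushforward : ∀ c P → lincomb c b P ≡ lincomb c (pushforward ∘ b) (p P)
    lincomb-pushforward c P = Σ₂-cong λ k → cong (c k ∧_) (sym (pushforward-pullback (b k) P))

  kernel-characterisation-invariant : KernelCharacterisation F → KernelCharacterisation G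
  kernel-characterisation-invariant characterisation f =
    ⇔.trans (⇔.sym kernel-pullback) (⇔.trans (characterisation (f ∘ p))
      (Σ-cong {k = equivalence} line (λ {D} → ≗-by-line not f D) ⊎-⇔ ≗-⟨$⟩ʳ point))
    where
    kernel-pullback : InKernel F (f ∘ p) ⇔ InKernel G f
    kernel-pullback = ⇔.trans (≗-respˡ (radon-pullback f)) (≗-⟨$⟩ʳ line)

  image-pullback : ∀ h → InImage F (h ∘ ℓ) ⇔ InImage G h
  image-pullback h = mk⇔ (λ (g , g★≗h) → pushforward g , radon-pushforward g g★≗h)
                         (λ (g , g★≗h) → g ∘ p , λ D → trans (radon-pullback g D) (g★≗h (ℓ D)))

  image-criterion-invariant : ImageCriterion F → ImageCriterion G
  image-criterion-invariant criterion h =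
    ⇔.trans (⇔.sym (image-pullback h)) (⇔.trans (criterion (h ∘ ℓ)) (mk⇔
      (λ equal → ∀-⟨$⟩ʳ line λ D₁ → ∀-⟨$⟩ʳ line λ D₂ → ∀-⟨$⟩ʳ line λ D₃ →
                 ∀-⟨$⟩ʳ line λ D₁' → ∀-⟨$⟩ʳ line λ D₂' → ∀-⟨$⟩ʳ line λ D₃' → λ dc dc' →
        equal D₁ D₂ D₃ D₁' D₂' D₃' (Equivalence.from (distinct-concurrent-pullback D₁ D₂ D₃) dc)
                                   (Equivalence.from (distinct-concurrent-pullback D₁' D₂' D₃') dc'))
      (λ equal D₁ D₂ D₃ D₁' D₂' D₃' dc dc' →
        equal (ℓ D₁) (ℓ D₂) (ℓ D₃) (ℓ D₁') (ℓ D₂') (ℓ D₃')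
          (Equivalence.to (distinct-concurrent-pullback D₁ D₂ D₃) dc)
          (Equivalence.to (distinct-concurrent-pullback D₁' D₂' D₃') dc'))))

  image-characterisation-invariant : ImageCharacterisation F → ImageCharacterisation G
  image-characterisation-invariant characterisation h =
    ⇔.trans (⇔.sym (image-pullback h)) (⇔.trans (characterisation (h ∘ ℓ))
      (Σ-cong {k = equivalence} point (λ {P} → ≗-by-point not h P ⊎-⇔ ≗-by-point (not ∘ not) h P)
        ⊎-⇔ ≗-⟨$⟩ʳ line ⊎-⇔ ≗-⟨$⟩ʳ line))

  S₀-pullback : ∀ f → InS₀ F (f ∘ p) ⇔ InS₀ G f
  S₀-pullback f = ≡-respˡ (Σ₂-permute f point)

  S₀-criterion-invariant : S₀Criterion F → S₀Criterion G
  S₀-criterion-invariant criterion f =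
    ⇔.trans (⇔.sym (Σ-cong {k = equivalence} point (λ {P} → via-radon-pullback (≗-by-point not (radon G f) P))
                     ⊎-⇔ via-radon-pullback (≗-⟨$⟩ʳ line)))
      (⇔.trans (criterion (f ∘ p)) (S₀-pullback f))
    where
    via-radon-pullback : ∀ {w} {A : Set} → (radon G f ∘ ℓ ≗ w) ⇔ A → (radon F (f ∘ p) ≗ w) ⇔ A
    via-radon-pullback = ⇔.trans (≗-respˡ (radon-pullback f))

  S₀-image-criterion-invariant : S₀ImageCriterion F → S₀ImageCriterion G
  S₀-image-criterion-invariant criterion h =
    ⇔.trans (⇔.sym S₀-image-pullback) (⇔.trans (criterion (h ∘ ℓ)) (mk⇔
      (λ balanced → ∀-⟨$⟩ʳ line λ D₁ → ∀-⟨$⟩ʳ line λ D₂ → ∀-⟨$⟩ʳ line λ D₃ → λ dc →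
        balanced D₁ D₂ D₃ (Equivalence.from (distinct-concurrent-pullback D₁ D₂ D₃) dc))
      (λ balanced D₁ D₂ D₃ dc →
        balanced (ℓ D₁) (ℓ D₂) (ℓ D₃) (Equivalence.to (distinct-concurrent-pullback D₁ D₂ D₃) dc))))
    where
    S₀-image-pullback : (∃ λ g → InS₀ F g × radon F g ≗ h ∘ ℓ) ⇔ (∃ λ g → InS₀ G g × radon G g ≗ h)
    S₀-image-pullback = mk⇔
      (λ (g , g∈S₀ , g★≗h) → pushforward g , trans (Σ₂-pushforward g) g∈S₀ , radon-pushforward g g★≗h)
      (λ (g , g∈S₀ , g★≗h) →
        g ∘ p , Equivalence.from (S₀-pullback g) g∈S₀ , λ D → trans (radon-pullback g D) (g★≗h (ℓ D)))
-- Every Fano plane is isomorphic to the standard one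

module Coordinatisation (F : FanoPlane) where
  open FanoPlane F

  join : (P Q : Fin 7) → P ≢ Q → Fin 7
  join P Q P≢Q = proj₁ (two-points P Q P≢Q)

  join-∋ˡ : ∀ {P Q} (P≢Q : P ≢ Q) → P ∈ join P Q P≢Q
  join-∋ˡ {P} {Q} P≢Q = proj₁ (proj₂ (two-points P Q P≢Q))

  join-∋ʳ : ∀ {P Q} (P≢Q : P ≢ Q) → Q ∈ join P Q P≢Q
  join-∋ʳ {P} {Q} P≢Q = proj₁ (proj₂ (proj₂ (two-points P Q P≢Q)))

  join-unique : ∀ {P Q D E} → P ≢ Q → P ∈ D → Q ∈ D → P ∈ E → Q ∈ E → D ≡ E
  join-unique {P} {Q} {D} {E} P≢Q P∈D Q∈D P∈E Q∈E =
    trans (unique D P∈D Q∈D) (sym (unique E P∈E Q∈E))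
    where
    unique : ∀ D' → P ∈ D' → Q ∈ D' → D' ≡ join P Q P≢Q
    unique = proj₂ (proj₂ (proj₂ (two-points P Q P≢Q)))

  meet : (D E : Fin 7) → D ≢ E → Fin 7
  meet D E D≢E = proj₁ (two-lines D E D≢E)

  meet-∈ˡ : ∀ {D E} (D≢E : D ≢ E) → meet D E D≢E ∈ D
  meet-∈ˡ {D} {E} D≢E = proj₁ (proj₂ (two-lines D E D≢E))

  meet-∈ʳ : ∀ {D E} (D≢E : D ≢ E) → meet D E D≢E ∈ E
  meet-∈ʳ {D} {E} D≢E = proj₁ (proj₂ (proj₂ (two-lines D E D≢E)))

  meet-unique : ∀ {D E P Q} → D ≢ E → P ∈ D → P ∈ E → Q ∈ D → Q ∈ E → P ≡ Q
  meet-unique {D} {E} {P} {Q} D≢E P∈D P∈E Q∈D Q∈E =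
    trans (unique P P∈D P∈E) (sym (unique Q Q∈D Q∈E))
    where
    unique : ∀ P' → P' ∈ D → P' ∈ E → P' ≡ meet D E D≢E
    unique = proj₂ (proj₂ (proj₂ (two-lines D E D≢E)))

  ∈-≢ : ∀ {P Q D} → P ∈ D → ¬ Q ∈ D → P ≢ Q
  ∈-≢ P∈D Q∉D refl = Q∉D P∈D

  ∋-≢ : ∀ {P D E} → P ∈ D → ¬ P ∈ E → D ≢ E
  ∋-≢ P∈D P∉E refl = P∉E P∈D

  meet-∉ : ∀ {D E G P R} (D≢E : D ≢ E) → P ∈ D → ¬ P ∈ E → P ∈ G → R ∈ G → ¬ R ∈ D → ¬ meet D E D≢E ∈ G
  meet-∉ {E = E} D≢E P∈D P∉E P∈G R∈G R∉D X∈G =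
    P∉E (subst (_∈ E) (meet-unique (∋-≢ R∈G R∉D ∘ sym) (meet-∈ˡ D≢E) X∈G P∈D P∈G) (meet-∈ʳ D≢E))

  join-∉ : ∀ {P Q R D E} → P ≢ Q → P ∈ D → Q ∈ D → Q ∈ E → R ∈ E → ¬ R ∈ D → ¬ P ∈ E
  join-∉ {R = R} P≢Q P∈D Q∈D Q∈E R∈E R∉D P∈E = R∉D (subst (R ∈_) (join-unique P≢Q P∈E Q∈E P∈D Q∈D) R∈E)

  q : Fin 4 → Fin 7
  q = proj₁ four-points

  side : (i j : Fin 4) → {False (i ≟ j)} → Fin 7
  side i j {i≢j} = join (q i) (q j) (proj₁ (proj₂ four-points) i j (toWitnessFalse i≢j))

  side-∋ˡ : ∀ i j {i≢j : False (i ≟ j)} → q i ∈ side i j {i≢j}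
  side-∋ˡ i j = join-∋ˡ _

  side-∋ʳ : ∀ i j {i≢j : False (i ≟ j)} → q j ∈ side i j {i≢j}
  side-∋ʳ i j = join-∋ʳ _

  side-∌ : ∀ i j k {i≢j : False (i ≟ j)} {j≢k : False (j ≟ k)} {i≢k : False (i ≟ k)} → ¬ q k ∈ side i j {i≢j}
  side-∌ i j k {i≢j} {j≢k} {i≢k} qk∈side =
    proj₂ (proj₂ four-points) i j k (toWitnessFalse i≢j) (toWitnessFalse j≢k) (toWitnessFalse i≢k)
      (side i j {i≢j} , side-∋ˡ i j {i≢j} , side-∋ʳ i j {i≢j} , qk∈side)

  d₁ d₂ d₃ : Fin 7
  d₁ = meet (side 0F 1F) (side 2F 3F) (∋-≢ (side-∋ˡ 0F 1F) (side-∌ 2F 3F 0F))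
  d₂ = meet (side 0F 2F) (side 1F 3F) (∋-≢ (side-∋ˡ 0F 2F) (side-∌ 1F 3F 0F))
  d₃ = meet (side 0F 3F) (side 1F 2F) (∋-≢ (side-∋ˡ 0F 3F) (side-∌ 1F 2F 0F))

  d₁∉side₀₂ : ¬ d₁ ∈ side 0F 2F
  d₁∉side₀₂ = meet-∉ _ (side-∋ˡ 0F 1F) (side-∌ 2F 3F 0F) (side-∋ˡ 0F 2F) (side-∋ʳ 0F 2F) (side-∌ 0F 1F 2F)
  d₁∉side₀₃ : ¬ d₁ ∈ side 0F 3F
  d₁∉side₀₃ = meet-∉ _ (side-∋ˡ 0F 1F) (side-∌ 2F 3F 0F) (side-∋ˡ 0F 3F) (side-∋ʳ 0F 3F) (side-∌ 0F 1F 3F)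
  d₁∉side₁₂ : ¬ d₁ ∈ side 1F 2F
  d₁∉side₁₂ = meet-∉ _ (side-∋ʳ 0F 1F) (side-∌ 2F 3F 1F) (side-∋ˡ 1F 2F) (side-∋ʳ 1F 2F) (side-∌ 0F 1F 2F)
  d₁∉side₁₃ : ¬ d₁ ∈ side 1F 3F
  d₁∉side₁₃ = meet-∉ _ (side-∋ʳ 0F 1F) (side-∌ 2F 3F 1F) (side-∋ˡ 1F 3F) (side-∋ʳ 1F 3F) (side-∌ 0F 1F 3F)

  d₂∉side₀₁ : ¬ d₂ ∈ side 0F 1F
  d₂∉side₀₁ = meet-∉ _ (side-∋ˡ 0F 2F) (side-∌ 1F 3F 0F) (side-∋ˡ 0F 1F) (side-∋ʳ 0F 1F) (side-∌ 0F 2F 1F)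
  d₂∉side₀₃ : ¬ d₂ ∈ side 0F 3F
  d₂∉side₀₃ = meet-∉ _ (side-∋ˡ 0F 2F) (side-∌ 1F 3F 0F) (side-∋ˡ 0F 3F) (side-∋ʳ 0F 3F) (side-∌ 0F 2F 3F)
  d₂∉side₁₂ : ¬ d₂ ∈ side 1F 2F
  d₂∉side₁₂ = meet-∉ _ (side-∋ʳ 0F 2F) (side-∌ 1F 3F 2F) (side-∋ʳ 1F 2F) (side-∋ˡ 1F 2F) (side-∌ 0F 2F 1F)
  d₂∉side₂₃ : ¬ d₂ ∈ side 2F 3F
  d₂∉side₂₃ = meet-∉ _ (side-∋ʳ 0F 2F) (side-∌ 1F 3F 2F) (side-∋ˡ 2F 3F) (side-∋ʳ 2F 3F) (side-∌ 0F 2F 3F)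

  d₃∉side₀₁ : ¬ d₃ ∈ side 0F 1F
  d₃∉side₀₁ = meet-∉ _ (side-∋ˡ 0F 3F) (side-∌ 1F 2F 0F) (side-∋ˡ 0F 1F) (side-∋ʳ 0F 1F) (side-∌ 0F 3F 1F)
  d₃∉side₀₂ : ¬ d₃ ∈ side 0F 2F
  d₃∉side₀₂ = meet-∉ _ (side-∋ˡ 0F 3F) (side-∌ 1F 2F 0F) (side-∋ˡ 0F 2F) (side-∋ʳ 0F 2F) (side-∌ 0F 3F 2F)
  d₃∉side₁₃ : ¬ d₃ ∈ side 1F 3F
  d₃∉side₁₃ = meet-∉ _ (side-∋ʳ 0F 3F) (side-∌ 1F 2F 3F) (side-∋ʳ 1F 3F) (side-∋ˡ 1F 3F) (side-∌ 0F 3F 1F)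
  d₃∉side₂₃ : ¬ d₃ ∈ side 2F 3F
  d₃∉side₂₃ = meet-∉ _ (side-∋ʳ 0F 3F) (side-∌ 1F 2F 3F) (side-∋ʳ 2F 3F) (side-∋ˡ 2F 3F) (side-∌ 0F 3F 2F)

  d₁≢d₂ : d₁ ≢ d₂
  d₁≢d₂ = ∈-≢ (meet-∈ˡ _) d₂∉side₀₁

  diagonal : Fin 7
  diagonal = join d₁ d₂ d₁≢d₂

  q₀∉diagonal : ¬ q 0F ∈ diagonal
  q₀∉diagonal = join-∉ (∈-≢ (side-∋ˡ 0F 2F) d₁∉side₀₂) (side-∋ˡ 0F 1F) (meet-∈ˡ _) (join-∋ˡ _) (join-∋ʳ _) d₂∉side₀₁
  q₁∉diagonal : ¬ q 1F ∈ diagonal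
  q₁∉diagonal = join-∉ (∈-≢ (side-∋ˡ 1F 2F) d₁∉side₁₂) (side-∋ʳ 0F 1F) (meet-∈ˡ _) (join-∋ˡ _) (join-∋ʳ _) d₂∉side₀₁
  q₂∉diagonal : ¬ q 2F ∈ diagonal
  q₂∉diagonal = join-∉ (∈-≢ (side-∋ʳ 0F 2F) d₁∉side₀₂) (side-∋ˡ 2F 3F) (meet-∈ʳ _) (join-∋ˡ _) (join-∋ʳ _) d₂∉side₂₃
  q₃∉diagonal : ¬ q 3F ∈ diagonal
  q₃∉diagonal = join-∉ (∈-≢ (side-∋ʳ 0F 3F) d₁∉side₀₃) (side-∋ʳ 2F 3F) (meet-∈ʳ _) (join-∋ˡ _) (join-∋ʳ _) d₂∉side₂₃

  point : Fin 7 → Fin 7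
  point 0F = q 0F
  point 1F = q 1F
  point 2F = q 2F
  point 3F = q 3F
  point 4F = d₁
  point 5F = d₂
  point 6F = d₃

  line : Fin 7 → Fin 7
  line 0F = side 0F 1F
  line 1F = side 0F 2F
  line 2F = side 0F 3F
  line 3F = side 1F 2F
  line 4F = side 1F 3F
  line 5F = side 2F 3F
  line 6F = diagonal

  ∉⇒false : ∀ {P D} → ¬ P ∈ D → inc P D ≡ false
  ∉⇒false = ¬-not

  incidence-sides : ∀ i (j : Fin 6) → inc (point i) (line (inject₁ j)) ≡ inc₇ i (inject₁ j)
  incidence-sides 0F 0F = side-∋ˡ 0F 1F
  incidence-sides 0F 1F = side-∋ˡ 0F 2F
  incidence-sides 0F 2F = side-∋ˡ 0F 3F
  incidence-sides 0F 3F = ∉⇒false (side-∌ 1F 2F 0F)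
  incidence-sides 0F 4F = ∉⇒false (side-∌ 1F 3F 0F)
  incidence-sides 0F 5F = ∉⇒false (side-∌ 2F 3F 0F)
  incidence-sides 1F 0F = side-∋ʳ 0F 1F
  incidence-sides 1F 1F = ∉⇒false (side-∌ 0F 2F 1F)
  incidence-sides 1F 2F = ∉⇒false (side-∌ 0F 3F 1F)
  incidence-sides 1F 3F = side-∋ˡ 1F 2F
  incidence-sides 1F 4F = side-∋ˡ 1F 3F
  incidence-sides 1F 5F = ∉⇒false (side-∌ 2F 3F 1F)
  incidence-sides 2F 0F = ∉⇒false (side-∌ 0F 1F 2F)
  incidence-sides 2F 1F = side-∋ʳ 0F 2F
  incidence-sides 2F 2F = ∉⇒false (side-∌ 0F 3F 2F)
  incidence-sides 2F 3F = side-∋ʳ 1F 2F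
  incidence-sides 2F 4F = ∉⇒false (side-∌ 1F 3F 2F)
  incidence-sides 2F 5F = side-∋ˡ 2F 3F
  incidence-sides 3F 0F = ∉⇒false (side-∌ 0F 1F 3F)
  incidence-sides 3F 1F = ∉⇒false (side-∌ 0F 2F 3F)
  incidence-sides 3F 2F = side-∋ʳ 0F 3F
  incidence-sides 3F 3F = ∉⇒false (side-∌ 1F 2F 3F)
  incidence-sides 3F 4F = side-∋ʳ 1F 3F
  incidence-sides 3F 5F = side-∋ʳ 2F 3F
  incidence-sides 4F 0F = meet-∈ˡ _
  incidence-sides 4F 1F = ∉⇒false d₁∉side₀₂
  incidence-sides 4F 2F = ∉⇒false d₁∉side₀₃
  incidence-sides 4F 3F = ∉⇒false d₁∉side₁₂
  incidence-sides 4F 4F = ∉⇒false d₁∉side₁₃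
  incidence-sides 4F 5F = meet-∈ʳ _
  incidence-sides 5F 0F = ∉⇒false d₂∉side₀₁
  incidence-sides 5F 1F = meet-∈ˡ _
  incidence-sides 5F 2F = ∉⇒false d₂∉side₀₃
  incidence-sides 5F 3F = ∉⇒false d₂∉side₁₂
  incidence-sides 5F 4F = meet-∈ʳ _
  incidence-sides 5F 5F = ∉⇒false d₂∉side₂₃
  incidence-sides 6F 0F = ∉⇒false d₃∉side₀₁
  incidence-sides 6F 1F = ∉⇒false d₃∉side₀₂
  incidence-sides 6F 2F = meet-∈ˡ _
  incidence-sides 6F 3F = meet-∈ʳ _
  incidence-sides 6F 4F = ∉⇒false d₃∉side₁₃
  incidence-sides 6F 5F = ∉⇒false d₃∉side₂₃

  point-injective : Injective _≡_ _≡_ point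
  point-injective {i} {k} point-i≡point-k = rows-differ i k λ j →
    trans (sym (incidence-sides i j)) (trans (cong (λ P → inc P (line (inject₁ j))) point-i≡point-k) (incidence-sides k j))
    where
    rows-differ : ∀ i k → (∀ (j : Fin 6) → inc₇ i (inject₁ j) ≡ inc₇ k (inject₁ j)) → i ≡ k
    rows-differ = from-yes (all? λ i → all? λ k → (all? λ j → inc₇ i (inject₁ j) ≟ᵇ inc₇ k (inject₁ j)) →-dec i ≟ k)

  d₃∈diagonal : d₃ ∈ diagonal
  d₃∈diagonal = labelled (injective⇒surjective point-injective (meet _ _ side₀₃≢diagonal))
    where
    side₀₃≢diagonal : side 0F 3F ≢ diagonal
    side₀₃≢diagonal = ∋-≢ (side-∋ˡ 0F 3F) q₀∉diagonal
    on-side₀₃-and-diagonal : ∀ i → point i ∈ side 0F 3F → point i ∈ diagonal → d₃ ∈ diagonal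
    on-side₀₃-and-diagonal 0F _ ∈diagonal = contradiction ∈diagonal q₀∉diagonal
    on-side₀₃-and-diagonal 1F ∈side _ = contradiction ∈side (side-∌ 0F 3F 1F)
    on-side₀₃-and-diagonal 2F ∈side _ = contradiction ∈side (side-∌ 0F 3F 2F)
    on-side₀₃-and-diagonal 3F _ ∈diagonal = contradiction ∈diagonal q₃∉diagonal
    on-side₀₃-and-diagonal 4F ∈side _ = contradiction ∈side d₁∉side₀₃
    on-side₀₃-and-diagonal 5F ∈side _ = contradiction ∈side d₂∉side₀₃
    on-side₀₃-and-diagonal 6F _ ∈diagonal = ∈diagonal
    labelled : (∃ λ i → point i ≡ meet _ _ side₀₃≢diagonal) → d₃ ∈ diagonal
    labelled (i , point-i≡X) = on-side₀₃-and-diagonal i (subst (_∈ side 0F 3F) (sym point-i≡X) (meet-∈ˡ _))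
                                                         (subst (_∈ diagonal) (sym point-i≡X) (meet-∈ʳ _))

  incidence-diagonal : ∀ i → inc (point i) diagonal ≡ inc₇ i 6F
  incidence-diagonal 0F = ∉⇒false q₀∉diagonal
  incidence-diagonal 1F = ∉⇒false q₁∉diagonal
  incidence-diagonal 2F = ∉⇒false q₂∉diagonal
  incidence-diagonal 3F = ∉⇒false q₃∉diagonal
  incidence-diagonal 4F = join-∋ˡ _
  incidence-diagonal 5F = join-∋ʳ _
  incidence-diagonal 6F = d₃∈diagonal

  incidence : ∀ i j → inc (point i) (line j) ≡ inc₇ i j
  incidence i 0F = incidence-sides i 0F
  incidence i 1F = incidence-sides i 1F
  incidence i 2F = incidence-sides i 2F
  incidence i 3F = incidence-sides i 3F
  incidence i 4F = incidence-sides i 4F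
  incidence i 5F = incidence-sides i 5F
  incidence i 6F = incidence-diagonal i

  line-injective : Injective _≡_ _≡_ line
  line-injective {j} {k} line-j≡line-k = columns-differ j k λ i →
    trans (sym (incidence i j)) (trans (cong (inc (point i)) line-j≡line-k) (incidence i k))
    where
    columns-differ : ∀ j k → (∀ i → inc₇ i j ≡ inc₇ i k) → j ≡ k
    columns-differ = from-yes (all? λ j → all? λ k → (all? λ i → inc₇ i j ≟ᵇ inc₇ i k) →-dec j ≟ k)
coordinatisation : (F : FanoPlane) → Fano₇ ≅ F
coordinatisation F = record
  { point     = injective⇒permutation point point-injective
  ; line      = injective⇒permutation line line-injective
  ; incidence = incidence
  }
  where open Coordinatisation F

proposition2p19 : (F : FanoPlane) →
    -- (1) T(ℱ) is a ℤ₂-vector space of dimension three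
    (∃ λ (b : Fin 3 → S F) → IsBasisOf (InKernel F) b) ×
    -- (2) T(ℱ) = {T_D : D ∈ ℱ*} ∪ {0}
    (∀ (f : S F) → InKernel F f ⇔
      ((∃ λ (D : Line F) → f ≗ T-line F D) ⊎ f ≗ (λ _ → false))) ×
    -- (3) characterisation of the image by concurrent triples
    (∀ (f : S* F) → InImage F f ⇔
      (∀ D₁ D₂ D₃ D₁' D₂' D₃' → DistinctConcurrent F D₁ D₂ D₃ →
        DistinctConcurrent F D₁' D₂' D₃' →
        (f D₁ xor f D₂ xor f D₃) ≡ (f D₁' xor f D₂' xor f D₃'))) ×
    -- (4) the image is {T_P, T_P + 1 : P ∈ ℱ} ∪ {0, 1}
    (∀ (f : S* F) → InImage F f ⇔
      ((∃ λ (P : Point F) → f ≗ T-point F P ⊎ f ≗ (λ D → not (T-point F P D)))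
        ⊎ f ≗ (λ _ → false) ⊎ f ≗ (λ _ → true))) ×
    -- (5) f★ = T_P for some P, or f★ ≡ 0, iff f ∈ 𝒮₀(ℱ)
    (∀ (f : S F) →
      ((∃ λ (P : Point F) → radon F f ≗ T-point F P) ⊎ radon F f ≗ (λ _ → false))
        ⇔ InS₀ F f) ×
    -- (5, in particular) 𝒮₀(ℱ)★ = {h : Σ h(Dᵢ) = 0 for distinct concurrent D₁,D₂,D₃}
    (∀ (h : S* F) → (∃ λ (g : S F) → InS₀ F g × radon F g ≗ h) ⇔
      (∀ D₁ D₂ D₃ → DistinctConcurrent F D₁ D₂ D₃ →
        (h D₁ xor h D₂ xor h D₃) ≡ false))
proposition2p19 F =
  kernel-basis-invariant kernel-basis₇ ,
  kernel-characterisation-invariant kernel-characterisation₇ ,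
  image-criterion-invariant image-criterion₇ ,
  image-characterisation-invariant image-characterisation₇ ,
  S₀-criterion-invariant S₀-criterion₇ ,
  S₀-image-criterion-invariant S₀-image-criterion₇
  where open Invariance (coordinatisation F)
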